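{- Let $G$ be a connected graph and $\omega$ an integer. Then $G$ has a treedepth decomposition of depth at most $\omega$ if and only if $G$ has a derivation (in the treedepth sense) of length at most $\omega+1$.
   Context: Graphs are finite and undirected. A treedepth decomposition of $G$ is a rooted forest $F$ with vertex set $V(G)$ such that $G$ is a subgraph of the closure $C(F)$, the graph on $V(F)$ with an edge $uv$ whenever $u$ is an ancestor of $v$ in $F$. Its depth is the height of $F$, i.e. the maximum number of vertices on a root-to-node path. A weak partition of a set $S$ is a set of pairwise disjoint nonempty subsets of $S$. A derivation (in the treedepth sense) of $G$ of length $l$ is a sequence $(P_1,\dots,P_l)$ of weak partitions of $V(G)$ such that: (D1) $P_1=\emptyset$ and $P_l=\{V(G)\}$; (D2) for every $1\le i<l$, $P_i$ refines $P_{i+1}$ (every set of $P_i$ is contained in a set of $P_{i+1}$); (D3) for every $i$ and $p\in P_i$, $|\chi^i(p)|\le 1$; (D4) for every edge $uv\in E(G)$ there are $i$ and $p\in P_i$ with $\{u,v\}\subseteq p$ and $\chi^i(p)\cap\{u,v\}\ne\emptyset$. Here, for $p\in P_i$, $\chi^i(p)=p\setminus\bigcup\{c\in P_{i-1}: c\subseteq p\}$ (with $P_0$ read as empty). -}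

module Defs where

open import Data.Nat using (ℕ; zero; suc; _≤_)
open import Data.Integer as ℤ using (ℤ; +_)
open import Data.Fin using (Fin)
open import Data.Fin.Subset using (Subset; _∈_; _∉_; _⊆_; Nonempty; ⊤)
open import Data.Maybe using (Maybe; just; nothing)
open import Data.Product using (Σ; ∃; ∃-syntax; _×_; _,_)
open import Data.Sum using (_⊎_)
open import Data.Empty using (⊥)
open import Relation.Nullary using (¬_)
open import Relation.Binary.PropositionalEquality using (_≡_; _≢_)
open import Function.Bundles using (_⇔_)

record Graph (n : ℕ) : Set₁ where
  field
    Adj       : Fin n → Fin n → Set
    adj-sym   : ∀ {u v} → Adj u v → Adj v u
    adj-irrefl : ∀ {u} → ¬ Adj u u
open Graph public

data Walk {n} (G : Graph n) : Fin n → Fin n → Set where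
  here : ∀ {v} → Walk G v v
  step : ∀ {u w v} → Adj G u w → Walk G w v → Walk G u v

Connected : ∀ {n} → Graph n → Set
Connected {n} G = Fin n × (∀ u v → Walk G u v)

-- Height par v k : the root-to-v path has exactly k vertices.
data Height {n} (par : Fin n → Maybe (Fin n)) : Fin n → ℕ → Set where
  root : ∀ {v} → par v ≡ nothing → Height par v 1
  step : ∀ {v u k} → par v ≡ just u → Height par u k → Height par v (suc k)

-- A rooted forest: a parent map in which every vertex reaches a root
-- (i.e. no cycles).
record RootedForest (n : ℕ) : Set where
  field
    parent    : Fin n → Maybe (Fin n)
    reachRoot : ∀ v → ∃[ k ] Height parent v k
open RootedForest public

data Ancestor {n} (F : RootedForest n) : Fin n → Fin n → Set where
  par  : ∀ {u v} → parent F v ≡ just u → Ancestor F u v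
  up   : ∀ {u w v} → parent F v ≡ just w → Ancestor F u w → Ancestor F u v

ClosureEdge : ∀ {n} → RootedForest n → Fin n → Fin n → Set
ClosureEdge F u v = Ancestor F u v ⊎ Ancestor F v u

IsTreedepthDecomposition : ∀ {n} → Graph n → RootedForest n → Set
IsTreedepthDecomposition G F = ∀ u v → Adj G u v → ClosureEdge F u v

DepthAtMost : ∀ {n} → RootedForest n → ℤ → Set
DepthAtMost F d = ∀ v k → Height (parent F) v k → (+ k) ℤ.≤ d

HasTDDOfDepthAtMost : ∀ {n} → Graph n → ℤ → Set
HasTDDOfDepthAtMost {n} G ω =
  Σ (RootedForest n) λ F → IsTreedepthDecomposition G F × DepthAtMost F ω

record WeakPartition (n : ℕ) : Set where
  field
    size     : ℕ
    block    : Fin size → Subset n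
    nonempty : ∀ j → Nonempty (block j)
    disjoint : ∀ j j' → j ≢ j' → ∀ v → v ∈ block j → v ∉ block j'
open WeakPartition public

emptyWP : ∀ {n} → WeakPartition n
emptyWP = record { size = 0 ; block = λ () ; nonempty = λ () ; disjoint = λ () }

Refines : ∀ {n} → WeakPartition n → WeakPartition n → Set
Refines P Q = ∀ j → ∃[ j' ] block P j ⊆ block Q j'

-- v ∈ χ(p) relative to the previous partition Prev:
-- χ(p) = p \ ⋃ { c ∈ Prev : c ⊆ p }
InChi : ∀ {n} → WeakPartition n → Subset n → Fin n → Set
InChi Prev p v = v ∈ p × (∀ j → block Prev j ⊆ p → v ∉ block Prev j)

-- A sequence P_1, ..., P_l is a function ℕ → WeakPartition n, of which
-- only the indices 1..l matter.  The previous partition of index i,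
-- with P_0 read as empty.
prevWP : ∀ {n} → (ℕ → WeakPartition n) → ℕ → WeakPartition n
prevWP P zero          = emptyWP
prevWP P (suc zero)    = emptyWP
prevWP P (suc (suc i)) = P (suc i)

Chi : ∀ {n} → (ℕ → WeakPartition n) → (i : ℕ) → Subset n → Fin n → Set
Chi P i p v = InChi (prevWP P i) p v

record IsDerivation {n} (G : Graph n) (l : ℕ) (P : ℕ → WeakPartition n) : Set where
  field
    length≥1 : 1 ≤ l
    first-empty : size (P 1) ≡ 0
    last-size   : size (P l) ≡ 1
    last-full   : ∀ j → block (P l) j ≡ ⊤
    refines : ∀ i → 1 ≤ i → suc i ≤ l → Refines (P i) (P (suc i))
    chi-small : ∀ i → 1 ≤ i → i ≤ l → ∀ j u v →
                Chi P i (block (P i) j) u → Chi P i (block (P i) j) v → u ≡ v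
    edges : ∀ u v → Adj G u v →
            ∃[ i ] (1 ≤ i × i ≤ l × ∃[ j ]
              (u ∈ block (P i) j × v ∈ block (P i) j ×
               (Chi P i (block (P i) j) u ⊎ Chi P i (block (P i) j) v)))

HasDerivationOfLengthAtMost : ∀ {n} → Graph n → ℤ → Set
HasDerivationOfLengthAtMost {n} G m =
  ∃[ l ] ((+ l) ℤ.≤ m × Σ (ℕ → WeakPartition n) (IsDerivation G l))

-- A forest of depth d gives a derivation of length d + 1: P_i consists of the
-- subtrees rooted at the vertices of height d + 2 - i, so that χ of such a
-- subtree is its root, and an edge from u to a descendant is witnessed by the
-- subtree of u.  Conversely, from a derivation let the birth of v be the first
-- index at which v is covered, and let the parent of v be the χ-vertex of the
-- first block after its birth with nonempty χ that contains v.  Births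
-- strictly increase towards the root and lie in [2, l], which bounds the depth
-- by l - 1; following parents from v one meets every χ-vertex of a block
-- containing v, so every edge of G joins an ancestor to a descendant.
module Submission where

open import Defs
open import Data.Nat using (ℕ; zero; suc; _+_; _≤_; _<_; _≤?_; _≟_; z≤n; s≤s; s≤s⁻¹)
open import Data.Nat.Properties
open import Data.Integer as ℤ using (ℤ; +_; -[1+_]; +≤+)
open import Data.Integer.Properties using (drop‿+≤+)
open import Data.Fin using (Fin; zero; suc)
open import Data.Fin.Properties using (any?; all?) renaming (_≟_ to _≟ᶠ_)
open import Data.Fin.Subset using (Subset; _∈_; _⊆_; ⊤)
open import Data.Fin.Subset.Properties using (_∈?_; _⊆?_; ∈⊤; ⊆⊤; ⊆-antisym)
open import Data.List as List using (List; _∷_; filter; length; allFin)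
open import Data.List.Membership.Propositional using () renaming (_∈_ to _∈ˡ_)
open import Data.List.Membership.Propositional.Properties using (∈-lookup; ∈-allFin; ∈-filter⁺; ∈-filter⁻)
import Data.List.Relation.Unary.Any as Any
open import Data.List.Relation.Unary.Any.Properties using (lookup-index)
open import Data.List.Relation.Unary.Unique.Propositional using (Unique; _∷_)
open import Data.List.Relation.Unary.Unique.Propositional.Properties as Unique using (Unique[x∷xs]⇒x∉xs)
open import Data.Vec using (tabulate)
open import Data.Vec.Properties using (lookup∘tabulate; lookup⇒[]=; []=⇒lookup)
open import Data.Maybe using (Maybe; just; nothing)
open import Data.Maybe.Properties using (just-injective)
open import Data.Product using (∃; ∃-syntax; _×_; _,_; proj₁; proj₂)
open import Data.Sum using (_⊎_; inj₁; inj₂)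
open import Data.Empty using (⊥-elim)
open import Function using (_∘_)
open import Function.Bundles using (_⇔_; mk⇔)
open import Relation.Nullary using (¬_; Dec; yes; no; does; contradiction)
open import Relation.Nullary.Decidable using (dec-true; _×-dec_; _→-dec_; _⊎-dec_; ¬?)
open import Relation.Unary using (Decidable)
open import Relation.Binary.PropositionalEquality
open import Relation.Binary.Definitions using (tri<; tri≈; tri>)

record FirstAbove (P : ℕ → Set) (a : ℕ) : Set where
  field
    value   : ℕ
    above   : a ≤ value
    holds   : P value
    minimal : ∀ {k} → a ≤ k → k < value → ¬ P k
open FirstAbove

data FirstIn (P : ℕ → Set) (a b : ℕ) : Set where
  first : (r : FirstAbove P a) → value r < b → FirstIn P a b
  none  : (∀ {k} → a ≤ k → k < b → ¬ P k) → FirstIn P a b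

firstIn : ∀ {P : ℕ → Set} → Decidable P → ∀ a b → FirstIn P a b
firstIn P? a zero = none (λ _ ())
firstIn {P} P? a (suc b) with firstIn P? a b
... | first r r<b = first r (m<n⇒m<1+n r<b)
... | none none<b with a ≤? b
...   | no a≰b = none (λ a≤k k≤b _ → a≰b (≤-trans a≤k (s≤s⁻¹ k≤b)))
...   | yes a≤b with P? b
...     | yes Pb = first (record { value = b ; above = a≤b ; holds = Pb ; minimal = none<b }) ≤-refl
...     | no ¬Pb = none none≤b
  where
  none≤b : ∀ {k} → a ≤ k → k < suc b → ¬ P k
  none≤b a≤k k<1+b with m≤n⇒m<n∨m≡n (s≤s⁻¹ k<1+b)
  ... | inj₁ k<b  = none<b a≤k k<b
  ... | inj₂ refl = ¬Pb

least : ∀ {P : ℕ → Set} → Decidable P → ∀ {a m} → a ≤ m → P m → FirstAbove P a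
least P? {a} {m} a≤m Pm with firstIn P? a (suc m)
... | first r _     = r
... | none none≤m   = contradiction Pm (none≤m a≤m ≤-refl)

unique-lookup-injective : ∀ {A : Set} {xs : List A} → Unique xs →
                          ∀ {i j} → List.lookup xs i ≡ List.lookup xs j → i ≡ j
unique-lookup-injective {xs = _ ∷ _} u {zero}  {zero}  _ = refl
unique-lookup-injective {xs = _ ∷ _} u {zero}  {suc j} e =
  ⊥-elim (Unique[x∷xs]⇒x∉xs u (subst (_∈ˡ _) (sym e) (∈-lookup j)))
unique-lookup-injective {xs = _ ∷ _} u {suc i} {zero}  e =
  ⊥-elim (Unique[x∷xs]⇒x∉xs u (subst (_∈ˡ _) e (∈-lookup i)))
unique-lookup-injective {xs = _ ∷ _} (_ ∷ u) {suc i} {suc j} e = cong suc (unique-lookup-injective u e)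

Fin-empty⇒≡0 : ∀ {m} → ¬ Fin m → m ≡ 0
Fin-empty⇒≡0 {zero}  _      = refl
Fin-empty⇒≡0 {suc m} ¬Fin-m = ⊥-elim (¬Fin-m zero)

Fin-subsingleton⇒≡1 : ∀ {m} → Fin m → (∀ (i j : Fin m) → i ≡ j) → m ≡ 1
Fin-subsingleton⇒≡1 {suc zero}    _ _         = refl
Fin-subsingleton⇒≡1 {suc (suc m)} _ all-equal with all-equal zero (suc zero)
... | ()

module Enumeration {n : ℕ} {P : Fin n → Set} (P? : Decidable P) where

  private
    elements : List (Fin n)
    elements = filter P? (allFin n)

  count : ℕ
  count = length elements

  element : Fin count → Fin n
  element = List.lookup elements

  element-injective : ∀ {i j} → element i ≡ element j → i ≡ j
  element-injective = unique-lookup-injective (Unique.filter⁺ P? (Unique.allFin⁺ n))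

  element-sound : ∀ j → P (element j)
  element-sound j = proj₂ (∈-filter⁻ P? {xs = allFin n} (∈-lookup j))

  element-complete : ∀ {x} → P x → ∃[ j ] element j ≡ x
  element-complete Px = let x∈ = ∈-filter⁺ P? (∈-allFin _) Px in Any.index x∈ , sym (lookup-index x∈)

  count≡0 : (∀ x → ¬ P x) → count ≡ 0
  count≡0 ¬P = Fin-empty⇒≡0 (λ j → ¬P _ (element-sound j))

  count≡1 : ∀ {x} → P x → (∀ {y z} → P y → P z → y ≡ z) → count ≡ 1
  count≡1 Px P-unique =
    Fin-subsingleton⇒≡1 (proj₁ (element-complete Px))
      (λ i j → element-injective (P-unique (element-sound i) (element-sound j)))

module _ {n : ℕ} {P : Fin n → Set} (P? : Decidable P) where

  subsetOf : Subset n
  subsetOf = tabulate (does ∘ P?)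

  ∈-subsetOf⁺ : ∀ {x} → P x → x ∈ subsetOf
  ∈-subsetOf⁺ {x} Px = lookup⇒[]= x subsetOf (trans (lookup∘tabulate _ x) (dec-true (P? x) Px))

  ∈-subsetOf⁻ : ∀ {x} → x ∈ subsetOf → P x
  ∈-subsetOf⁻ {x} x∈ with P? x | trans (sym (lookup∘tabulate (does ∘ P?) x)) ([]=⇒lookup x∈)
  ... | yes Px | _ = Px
  ... | no _   | ()

module Forest {n : ℕ} (F : RootedForest n) where

  IsRoot : Fin n → Set
  IsRoot r = parent F r ≡ nothing

  height-unique : ∀ {v k k′} → Height (parent F) v k → Height (parent F) v k′ → k ≡ k′
  height-unique (root _)   (root _)     = refl
  height-unique (root e)   (step e′ _)  with trans (sym e) e′
  ... | ()
  height-unique (step e _) (root e′)    with trans (sym e) e′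
  ... | ()
  height-unique (step e H) (step e′ H′) with just-injective (trans (sym e) e′)
  ... | refl = cong suc (height-unique H H′)

  height : Fin n → ℕ
  height v = proj₁ (reachRoot F v)

  height-spec : ∀ v → Height (parent F) v (height v)
  height-spec v = proj₂ (reachRoot F v)

  height≥1 : ∀ {v k} → Height (parent F) v k → 1 ≤ k
  height≥1 (root _)   = s≤s z≤n
  height≥1 (step _ _) = s≤s z≤n

  height-parent : ∀ {v u} → parent F v ≡ just u → height v ≡ suc (height u)
  height-parent e = height-unique (height-spec _) (step e (height-spec _))

  height-root : ∀ {r} → IsRoot r → height r ≡ 1
  height-root e = height-unique (height-spec _) (root e)

  height≡1⇒root : ∀ {r} → height r ≡ 1 → IsRoot r
  height≡1⇒root {r} e with subst (Height (parent F) r) e (height-spec r)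
  ... | root e′    = e′
  ... | step _ ()

  root-no-ancestor : ∀ {a r} → IsRoot r → ¬ Ancestor F a r
  root-no-ancestor e (par e′)  with trans (sym e) e′
  ... | ()
  root-no-ancestor e (up e′ _) with trans (sym e) e′
  ... | ()

  ancestor⇒height< : ∀ {a b} → Ancestor F a b → height a < height b
  ancestor⇒height< (par e)    = ≤-reflexive (sym (height-parent e))
  ancestor⇒height< (up e ab)  = <-trans (ancestor⇒height< ab) (≤-reflexive (sym (height-parent e)))

  ancestor-unique-at-height : ∀ {a b w} → Ancestor F a w → Ancestor F b w → height a ≡ height b → a ≡ b
  ancestor-unique-at-height (par e)     (par e′)     _ = just-injective (trans (sym e) e′)
  ancestor-unique-at-height (par e)     (up e′ bw)   h≡ with just-injective (trans (sym e) e′)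
  ... | refl = ⊥-elim (<-irrefl (sym h≡) (ancestor⇒height< bw))
  ancestor-unique-at-height (up e aw)   (par e′)     h≡ with just-injective (trans (sym e) e′)
  ... | refl = ⊥-elim (<-irrefl h≡ (ancestor⇒height< aw))
  ancestor-unique-at-height (up e aw)   (up e′ bw)   h≡ with just-injective (trans (sym e) e′)
  ... | refl = ancestor-unique-at-height aw bw h≡

  ancestor? : ∀ a {w k} → Height (parent F) w k → Dec (Ancestor F a w)
  ancestor? a (root e) = no (root-no-ancestor e)
  ancestor? a (step {u = u} e H) with a ≟ᶠ u | ancestor? a H
  ... | yes refl | _       = yes (par e)
  ... | no _     | yes au  = yes (up e au)
  ... | no a≢u   | no ¬au  = no λ where
    (par e′)    → a≢u (just-injective (trans (sym e′) e))
    (up e′ au′) → ¬au (subst (Ancestor F a) (just-injective (trans (sym e′) e)) au′)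

  infix 4 _≼_ _≼?_

  _≼_ : Fin n → Fin n → Set
  a ≼ w = a ≡ w ⊎ Ancestor F a w

  _≼?_ : ∀ a w → Dec (a ≼ w)
  a ≼? w = (a ≟ᶠ w) ⊎-dec ancestor? a (height-spec w)

  ≼⇒height≤ : ∀ {a w} → a ≼ w → height a ≤ height w
  ≼⇒height≤ (inj₁ refl) = ≤-refl
  ≼⇒height≤ (inj₂ aw)   = <⇒≤ (ancestor⇒height< aw)

  ≼-ancestor-trans : ∀ {a b c} → a ≼ b → Ancestor F b c → Ancestor F a c
  ≼-ancestor-trans (inj₁ refl) bc        = bc
  ≼-ancestor-trans (inj₂ ab)   (par e)   = up e ab
  ≼-ancestor-trans (inj₂ ab)   (up e bc) = up e (≼-ancestor-trans (inj₂ ab) bc)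

  ancestor-≼-trans : ∀ {a b c} → Ancestor F a b → b ≼ c → Ancestor F a c
  ancestor-≼-trans ab (inj₁ refl) = ab
  ancestor-≼-trans ab (inj₂ bc)   = ≼-ancestor-trans (inj₂ ab) bc

  ≼-unique-at-height : ∀ {a b w} → a ≼ w → b ≼ w → height a ≡ height b → a ≡ b
  ≼-unique-at-height (inj₁ refl) (inj₁ refl) _  = refl
  ≼-unique-at-height (inj₁ refl) (inj₂ bw)   h≡ = ⊥-elim (<-irrefl (sym h≡) (ancestor⇒height< bw))
  ≼-unique-at-height (inj₂ aw)   (inj₁ refl) h≡ = ⊥-elim (<-irrefl h≡ (ancestor⇒height< aw))
  ≼-unique-at-height (inj₂ aw)   (inj₂ bw)   h≡ = ancestor-unique-at-height aw bw h≡

  child-towards : ∀ {a w} → Ancestor F a w → ∃[ c ] (parent F c ≡ just a × c ≼ w)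
  child-towards (par e)    = _ , e , inj₁ refl
  child-towards (up e aw′) with child-towards aw′
  ... | c , c↑a , c≼w′ = c , c↑a , inj₂ (≼-ancestor-trans c≼w′ (par e))

  subtree : Fin n → Subset n
  subtree a = subsetOf (a ≼?_)

  ∈-subtree⁺ : ∀ {a w} → a ≼ w → w ∈ subtree a
  ∈-subtree⁺ = ∈-subsetOf⁺ (_ ≼?_)

  ∈-subtree⁻ : ∀ {a w} → w ∈ subtree a → a ≼ w
  ∈-subtree⁻ = ∈-subsetOf⁻ (_ ≼?_)

  root-below : ∀ v → ∃[ r ] (IsRoot r × r ≼ v)
  root-below v = below (height-spec v)
    where
    below : ∀ {v k} → Height (parent F) v k → ∃[ r ] (IsRoot r × r ≼ v)
    below (root e)   = _ , e , inj₁ refl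
    below (step e H) with below H
    ... | r , r-root , r≼u = r , r-root , inj₂ (≼-ancestor-trans r≼u (par e))

  ≼-root : ∀ {a r} → IsRoot r → a ≼ r → a ≡ r
  ≼-root _      (inj₁ a≡r) = a≡r
  ≼-root r-root (inj₂ ar)  = ⊥-elim (root-no-ancestor r-root ar)

  roots-below-unique : ∀ {r r′ w} → IsRoot r → IsRoot r′ → r ≼ w → r′ ≼ w → r ≡ r′
  roots-below-unique r-root r′-root r≼w r′≼w =
    ≼-unique-at-height r≼w r′≼w (trans (height-root r-root) (sym (height-root r′-root)))

module DecompositionRoots {n : ℕ} (G : Graph n) {F : RootedForest n}
                          (tdd : IsTreedepthDecomposition G F) where
  open Forest F

  edge-preserves-root : ∀ {x y r} → Adj G x y → IsRoot r → r ≼ x → r ≼ y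
  edge-preserves-root {x} {y} xy r-root r≼x with tdd x y xy
  ... | inj₁ x↑y = inj₂ (≼-ancestor-trans r≼x x↑y)
  ... | inj₂ y↑x with root-below y
  ...   | r′ , r′-root , r′≼y =
    subst (_≼ y) (roots-below-unique r′-root r-root (inj₂ (≼-ancestor-trans r′≼y y↑x)) r≼x) r′≼y

  walk-preserves-root : ∀ {x y r} → Walk G x y → IsRoot r → r ≼ x → r ≼ y
  walk-preserves-root here          _      r≼x = r≼x
  walk-preserves-root (step xw wy) r-root r≼x =
    walk-preserves-root wy r-root (edge-preserves-root xw r-root r≼x)

  connected⇒roots-unique : Connected G → ∀ {r r′} → IsRoot r → IsRoot r′ → r ≡ r′
  connected⇒roots-unique conn r-root r′-root =
    ≼-root r′-root (walk-preserves-root (proj₂ conn _ _) r-root (inj₁ refl))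

module TreedepthToDerivation {n : ℕ} (G : Graph n) (conn : Connected G) (F : RootedForest n)
                             (tdd : IsTreedepthDecomposition G F)
                             (d : ℕ) (height≤d : ∀ v → Forest.height F v ≤ d) where
  open Forest F
  open DecompositionRoots G tdd

  roots-unique : ∀ {r r′} → IsRoot r → IsRoot r′ → r ≡ r′
  roots-unique = connected⇒roots-unique conn

  TopAt : ℕ → Fin n → Set
  TopAt i a = height a + i ≡ 2 + d

  module Tops (i : ℕ) = Enumeration (λ a → height a + i ≟ 2 + d)

  top : ∀ i → Fin (Tops.count i) → Fin n
  top = Tops.element

  top-at : ∀ i j → TopAt i (top i j)
  top-at = Tops.element-sound

  partition : ℕ → WeakPartition n
  partition i = record
    { size     = Tops.count i
    ; block    = subtree ∘ top i
    ; nonempty = λ j → top i j , ∈-subtree⁺ (inj₁ refl)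
    ; disjoint = λ j j′ j≢j′ v v∈ v∈′ → j≢j′ (Tops.element-injective i
        (≼-unique-at-height (∈-subtree⁻ v∈) (∈-subtree⁻ v∈′)
          (+-cancelʳ-≡ i _ _ (trans (top-at i j) (sym (top-at i j′))))))
    }

  parent-level : ∀ {c a} i → parent F c ≡ just a → height c + i ≡ height a + suc i
  parent-level {a = a} i e = trans (cong (_+ i) (height-parent e)) (sym (+-suc (height a) i))

  no-top-at-1 : ∀ a → ¬ TopAt 1 a
  no-top-at-1 a top-a = 1+n≰n (subst (_≤ d) height≡1+d (height≤d a))
    where height≡1+d = +-cancelʳ-≡ 1 _ _ (trans top-a (+-comm 1 (suc d)))

  top-at-last⇒root : ∀ {a} → TopAt (suc d) a → IsRoot a
  top-at-last⇒root top-a = height≡1⇒root (+-cancelʳ-≡ (suc d) _ 1 top-a)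

  first-empty : Tops.count 1 ≡ 0
  first-empty = Tops.count≡0 1 no-top-at-1

  last-size : Tops.count (suc d) ≡ 1
  last-size with root-below (proj₁ conn)
  ... | r , r-root , _ =
    Tops.count≡1 (suc d) (cong (_+ suc d) (height-root r-root))
      (λ top-a top-b → roots-unique (top-at-last⇒root top-a) (top-at-last⇒root top-b))

  last-full : ∀ j → subtree (top (suc d) j) ≡ ⊤
  last-full j = ⊆-antisym ⊆⊤ λ {w} _ → ∈-subtree⁺ (below w)
    where
    below : ∀ w → top (suc d) j ≼ w
    below w with root-below w
    ... | r , r-root , r≼w = subst (_≼ w) (roots-unique r-root (top-at-last⇒root (top-at (suc d) j))) r≼w

  refines : ∀ i → suc i ≤ suc d → Refines (partition i) (partition (suc i))
  refines i i<1+d j with parent F (top i j) in e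
  ... | nothing = ⊥-elim (1+n≰n (subst (_≤ d) i≡1+d (s≤s⁻¹ i<1+d)))
    where i≡1+d = suc-injective (trans (cong (_+ i) (sym (height-root e))) (top-at i j))
  ... | just p with Tops.element-complete (suc i) (trans (sym (parent-level i e)) (top-at i j))
  ...   | j′ , refl = j′ , λ w∈ → ∈-subtree⁺ (inj₂ (ancestor-≼-trans (par e) (∈-subtree⁻ w∈)))

  chi-top : ∀ i j → Chi partition (2 + i) (subtree (top (2 + i) j)) (top (2 + i) j)
  chi-top i j = ∈-subtree⁺ (inj₁ refl) , λ j′ _ a∈c →
    1+n≰n (subst (_≤ height a) (height-c j′) (≼⇒height≤ (∈-subtree⁻ a∈c)))
    where
    a = top (2 + i) j
    height-c : ∀ j′ → height (top (suc i) j′) ≡ suc (height a)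
    height-c j′ = +-cancelʳ-≡ (suc i) _ _
      (trans (top-at (suc i) j′) (trans (sym (top-at (2 + i) j)) (+-suc (height a) (suc i))))

  chi-only-top : ∀ i j {w} → Chi partition (2 + i) (subtree (top (2 + i) j)) w → w ≡ top (2 + i) j
  chi-only-top i j (w∈ , not-in-previous) with ∈-subtree⁻ w∈
  ... | inj₁ a≡w = sym a≡w
  ... | inj₂ a↑w with child-towards a↑w
  ...   | c , c↑a , c≼w
    with Tops.element-complete (suc i) (trans (parent-level (suc i) c↑a) (top-at (2 + i) j))
  ...     | j′ , refl = ⊥-elim (not-in-previous j′
              (λ x∈ → ∈-subtree⁺ (inj₂ (ancestor-≼-trans (par c↑a) (∈-subtree⁻ x∈)))) (∈-subtree⁺ c≼w))

  chi-small : ∀ i → 1 ≤ i → ∀ j u v → Chi partition i (subtree (top i j)) u →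
              Chi partition i (subtree (top i j)) v → u ≡ v
  chi-small (suc zero)    _ j _ _ _ _ = ⊥-elim (no-top-at-1 _ (top-at 1 j))
  chi-small (suc (suc i)) _ j _ _ χu χv = trans (chi-only-top i j χu) (sym (chi-only-top i j χv))

  ancestor-edge : ∀ {u v} → Ancestor F u v → ∃[ i ] (1 ≤ i × i ≤ suc d × ∃[ j ]
                    (u ∈ subtree (top i j) × v ∈ subtree (top i j) × Chi partition i (subtree (top i j)) u))
  ancestor-edge {u} u↑v with m≤n⇒∃[o]m+o≡n (height≤d u)
  ... | e , u+e≡d with Tops.element-complete (2 + e) top-u
    where
    top-u : TopAt (2 + e) u
    top-u = trans (+-suc (height u) (suc e)) (cong suc (trans (+-suc (height u) e) (cong suc u+e≡d)))
  ... | j , refl =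
    2 + e , s≤s z≤n , 2+e≤1+d , j , ∈-subtree⁺ (inj₁ refl) , ∈-subtree⁺ (inj₂ u↑v) , chi-top e j
    where
    2+e≤1+d : 2 + e ≤ suc d
    2+e≤1+d = s≤s (subst (suc e ≤_) u+e≡d (+-monoˡ-≤ e (height≥1 (height-spec _))))

  derivation : IsDerivation G (suc d) partition
  derivation = record
    { length≥1    = s≤s z≤n
    ; first-empty = first-empty
    ; last-size   = last-size
    ; last-full   = last-full
    ; refines     = λ i _ → refines i
    ; chi-small   = λ i 1≤i _ j → chi-small i 1≤i j
    ; edges       = λ u v uv → edge u v (tdd u v uv)
    }
    where
    edge : ∀ u v → ClosureEdge F u v → ∃[ i ] (1 ≤ i × i ≤ suc d × ∃[ j ]
             (u ∈ subtree (top i j) × v ∈ subtree (top i j) ×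
              (Chi partition i (subtree (top i j)) u ⊎ Chi partition i (subtree (top i j)) v)))
    edge u v (inj₁ u↑v) with ancestor-edge u↑v
    ... | i , 1≤i , i≤l , j , u∈ , v∈ , χu = i , 1≤i , i≤l , j , u∈ , v∈ , inj₁ χu
    edge u v (inj₂ v↑u) with ancestor-edge v↑u
    ... | i , 1≤i , i≤l , j , v∈ , u∈ , χv = i , 1≤i , i≤l , j , u∈ , v∈ , inj₂ χv

module RankedForest {n : ℕ} (par : Fin n → Maybe (Fin n)) (rank : Fin n → ℕ) (bound : ℕ)
                    (rank≤bound : ∀ v → rank v ≤ bound)
                    (rank-parent : ∀ {v u} → par v ≡ just u → rank v < rank u) where

  height-exists : ∀ v → ∃[ k ] Height par v k
  height-exists v = climb bound v (m≤m+n bound (rank v))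
    where
    climb : ∀ f v → bound ≤ f + rank v → ∃[ k ] Height par v k
    climb f v bound≤ with par v in e
    ... | nothing = 1 , root e
    ... | just u with f
    ...   | zero  = ⊥-elim (≤⇒≯ bound≤ (<-≤-trans (rank-parent e) (rank≤bound u)))
    ...   | suc f′ with climb f′ u (≤-trans bound≤ (≤-trans (≤-reflexive (sym (+-suc f′ (rank v))))
                                                           (+-monoʳ-≤ f′ (rank-parent e))))
    ...     | k , H = suc k , step e H

  forest : RootedForest n
  forest = record { parent = par ; reachRoot = height-exists }

  rank+height≤ : ∀ {v k} → Height par v k → rank v + k ≤ suc bound
  rank+height≤ {v} (root _)         = ≤-trans (≤-reflexive (+-comm (rank v) 1)) (s≤s (rank≤bound v))
  rank+height≤ {v} (step {k = k} e H) =
    ≤-trans (≤-reflexive (+-suc (rank v) k)) (≤-trans (+-monoˡ-≤ k (rank-parent e)) (rank+height≤ H))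

module DerivationToTreedepth {n : ℕ} (G : Graph n) (l : ℕ) (P : ℕ → WeakPartition n)
                             (D : IsDerivation G l P) where
  open IsDerivation D

  B : (i : ℕ) → Fin (size (P i)) → Subset n
  B i = block (P i)

  Covers : ℕ → Fin n → Set
  Covers i v = ∃[ j ] v ∈ B i j

  covers? : ∀ i v → Dec (Covers i v)
  covers? i v = any? (λ j → v ∈? B i j)

  chi? : ∀ i p v → Dec (Chi P i p v)
  chi? i p v = (v ∈? p) ×-dec all? λ j →
    (block (prevWP P i) j ⊆? p) →-dec ¬? (v ∈? block (prevWP P i) j)

  block-unique : ∀ {i j j′ v} → v ∈ B i j → v ∈ B i j′ → j ≡ j′
  block-unique {i} {j} {j′} v∈ v∈′ with j ≟ᶠ j′
  ... | yes j≡j′ = j≡j′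
  ... | no j≢j′  = ⊥-elim (disjoint (P i) j j′ j≢j′ _ v∈ v∈′)

  block-grows : ∀ {i k} → 1 ≤ i → i ≤ k → k ≤ l → ∀ j → ∃[ j′ ] B i j ⊆ B k j′
  block-grows {k = zero}  1≤i i≤0 _ j = ⊥-elim (≤⇒≯ i≤0 1≤i)
  block-grows {i} {suc k} 1≤i i≤1+k 1+k≤l j with m≤n⇒m<n∨m≡n i≤1+k
  ... | inj₂ refl = j , λ v∈ → v∈
  ... | inj₁ i<1+k with block-grows 1≤i (s≤s⁻¹ i<1+k) (<⇒≤ 1+k≤l) j
  ...   | j₁ , ⊆₁ with refines k (≤-trans 1≤i (s≤s⁻¹ i<1+k)) 1+k≤l j₁
  ...     | j₂ , ⊆₂ = j₂ , λ v∈ → ⊆₂ (⊆₁ v∈)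

  covers-mono : ∀ {i k v} → 1 ≤ i → i ≤ k → k ≤ l → Covers i v → Covers k v
  covers-mono 1≤i i≤k k≤l (j , v∈) = let j′ , ⊆′ = block-grows 1≤i i≤k k≤l j in j′ , ⊆′ v∈

  covered-at-end : ∀ v → Covers l v
  covered-at-end v = j , subst (v ∈_) (sym (last-full j)) ∈⊤
    where j = subst Fin (sym last-size) zero

  uncovered-at-1 : ∀ {v} → ¬ Covers 1 v
  uncovered-at-1 (j , _) with subst Fin first-empty j
  ... | ()

  -- Indices start at 1: P 0 is not part of the derivation.
  birth-spec : ∀ v → FirstAbove (λ i → Covers i v) 1
  birth-spec v = least (λ i → covers? i v) length≥1 (covered-at-end v)

  birth : Fin n → ℕ
  birth v = value (birth-spec v)

  birth-least : ∀ {i v} → 1 ≤ i → Covers i v → birth v ≤ i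
  birth-least 1≤i covered = ≮⇒≥ λ i<birth → minimal (birth-spec _) 1≤i i<birth covered

  birth≤l : ∀ v → birth v ≤ l
  birth≤l v = birth-least length≥1 (covered-at-end v)

  birth≥2 : ∀ {v} → 2 ≤ birth v
  birth≥2 {v} with m≤n⇒m<n∨m≡n (above (birth-spec v))
  ... | inj₁ 1<birth = 1<birth
  ... | inj₂ 1≡birth =
    ⊥-elim (uncovered-at-1 (subst (λ i → Covers i v) (sym 1≡birth) (holds (birth-spec v))))

  chi-at-birth : ∀ {v j} → v ∈ B (birth v) j → Chi P (birth v) (B (birth v) j) v
  chi-at-birth {v} = new (birth v) birth≥2 (minimal (birth-spec v))
    where
    new : ∀ b → 2 ≤ b → (∀ {k} → 1 ≤ k → k < b → ¬ Covers k v) → ∀ {j} → v ∈ B b j → Chi P b (B b j) v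
    new (suc zero)    (s≤s ()) _ _
    new (suc (suc _)) _ uncovered v∈ = v∈ , λ j′ _ v∈′ → uncovered (s≤s z≤n) ≤-refl (j′ , v∈′)

  chi⇒uncovered-before : ∀ {i j u} → i ≤ l → Chi P i (B i j) u → ∀ {k} → 1 ≤ k → k < i → ¬ Covers k u
  chi⇒uncovered-before {suc zero}    _   _                   (s≤s z≤n) (s≤s ())
  chi⇒uncovered-before {suc (suc m)} i≤l (u∈ , not-previous) 1≤k k<i covered
    with covers-mono 1≤k (s≤s⁻¹ k<i) (<⇒≤ i≤l) covered
  ... | c , u∈c with refines (suc m) (s≤s z≤n) i≤l c
  ... | j′ , c⊆ with block-unique (c⊆ u∈c) u∈
  ... | refl = not-previous c c⊆ u∈c

  chi⇒birth : ∀ {i j u} → 1 ≤ i → i ≤ l → Chi P i (B i j) u → birth u ≡ i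
  chi⇒birth {u = u} 1≤i i≤l χu with m≤n⇒m<n∨m≡n (birth-least 1≤i (_ , proj₁ χu))
  ... | inj₂ birth≡i = birth≡i
  ... | inj₁ birth<i =
    ⊥-elim (chi⇒uncovered-before i≤l χu (above (birth-spec u)) birth<i (holds (birth-spec u)))

  Claimed : Fin n → ℕ → Set
  Claimed v k = ∃[ u ] ∃[ j ] (Chi P k (B k j) u × v ∈ B k j)

  claimed? : ∀ v k → Dec (Claimed v k)
  claimed? v k = any? λ u → any? λ j → chi? k (B k j) u ×-dec (v ∈? B k j)

  parent-search : ∀ v → FirstIn (Claimed v) (suc (birth v)) (suc l)
  parent-search v = firstIn (claimed? v) (suc (birth v)) (suc l)

  parent-of : ∀ {v a b} → FirstIn (Claimed v) a b → Maybe (Fin n)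
  parent-of (first r _) = just (proj₁ (holds r))
  parent-of (none _)    = nothing

  parentMap : Fin n → Maybe (Fin n)
  parentMap v = parent-of (parent-search v)

  birth-parent : ∀ {v u} → parentMap v ≡ just u → birth v < birth u
  birth-parent {v} = from (parent-search v)
    where
    from : ∀ {u} (s : FirstIn (Claimed v) (suc (birth v)) (suc l)) → parent-of s ≡ just u → birth v < birth u
    from (first record { value = k ; above = birth<k ; holds = _ , _ , χu , _ } k<1+l) refl =
      subst (birth v <_) (sym (chi⇒birth (≤-trans (s≤s z≤n) birth<k) (s≤s⁻¹ k<1+l) χu)) birth<k

  open RankedForest parentMap birth l birth≤l birth-parent public using (forest; rank+height≤)

  claimer-above : ∀ f {i j u v} → i ≤ f + birth v → birth v < i → i ≤ l →
                  Chi P i (B i j) u → v ∈ B i j → Ancestor forest u v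
  claimer-above zero    i≤birth birth<i _ _ _ = ⊥-elim (≤⇒≯ i≤birth birth<i)
  claimer-above (suc f) {i} {j} {u} {v} i≤f+birth birth<i i≤l χu v∈ with parent-search v in eq
  ... | none unclaimed = ⊥-elim (unclaimed birth<i (s≤s i≤l) (u , j , χu , v∈))
  ... | first record { value = k ; above = birth<k ; holds = w , j′ , χw , v∈′ ; minimal = unclaimed } k<1+l
    with <-cmp k i
  ...   | tri> _ _ i<k = ⊥-elim (unclaimed birth<i i<k (u , j , χu , v∈))
  ...   | tri≈ _ refl _ with block-unique v∈′ v∈
  ...     | refl = par (trans (cong parent-of eq)
                             (cong just (chi-small k (≤-trans (s≤s z≤n) birth<i) i≤l j w u χw χu)))
  claimer-above (suc f) {i} {j} {u} {v} i≤f+birth birth<i i≤l χu v∈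
    | first record { value = k ; above = birth<k ; holds = w , j′ , χw , v∈′ } _ | tri< k<i _ _
    with block-grows (≤-trans (s≤s z≤n) birth<k) (<⇒≤ k<i) i≤l j′
  ... | j″ , k⊆i with block-unique (k⊆i v∈′) v∈
  ... | refl = up (cong parent-of eq)
                  (claimer-above f i≤f+birth-w (subst (_< i) (sym birth-w) k<i) i≤l χu (k⊆i (proj₁ χw)))
    where
    birth-w : birth w ≡ k
    birth-w = chi⇒birth (≤-trans (s≤s z≤n) birth<k) (≤-trans (<⇒≤ k<i) i≤l) χw
    i≤f+birth-w : i ≤ f + birth w
    i≤f+birth-w = ≤-trans i≤f+birth (≤-trans (≤-reflexive (sym (+-suc f (birth v))))
                                             (+-monoʳ-≤ f (subst (birth v <_) (sym birth-w) birth<k)))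

  claimer-is-ancestor : ∀ {i j u v} → 1 ≤ i → i ≤ l → Chi P i (B i j) u → v ∈ B i j → u ≢ v →
                        Ancestor forest u v
  claimer-is-ancestor {i} {j} {u} {v} 1≤i i≤l χu v∈ u≢v with m≤n⇒m<n∨m≡n (birth-least 1≤i (j , v∈))
  ... | inj₁ birth<i = claimer-above i (m≤m+n i (birth v)) birth<i i≤l χu v∈
  ... | inj₂ refl    = ⊥-elim (u≢v (chi-small (birth v) 1≤i i≤l j u v χu (chi-at-birth v∈)))

  decomposition : IsTreedepthDecomposition G forest
  decomposition u v uv with edges u v uv
  ... | _ , 1≤i , i≤l , _ , u∈ , v∈ , inj₁ χu = inj₁ (claimer-is-ancestor 1≤i i≤l χu v∈ u≢v)
    where u≢v = λ { refl → adj-irrefl G uv }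
  ... | _ , 1≤i , i≤l , _ , u∈ , v∈ , inj₂ χv = inj₂ (claimer-is-ancestor 1≤i i≤l χv u∈ v≢u)
    where v≢u = λ { refl → adj-irrefl G uv }

  height<l : ∀ {v k} → Height parentMap v k → suc k ≤ l
  height<l {v} {k} H = s≤s⁻¹ (≤-trans (+-monoˡ-≤ k (birth≥2 {v})) (rank+height≤ H))

treedepth⇒derivation : ∀ {n} (G : Graph n) → Connected G → ∀ ω →
                       HasTDDOfDepthAtMost G ω → HasDerivationOfLengthAtMost G (ω ℤ.+ + 1)
treedepth⇒derivation G conn (+ d) (F , tdd , depth≤d) =
  suc d , +≤+ (≤-reflexive (+-comm 1 d)) , partition , derivation
  where
  open TreedepthToDerivation G conn F tdd d (λ v → drop‿+≤+ (depth≤d v _ (Forest.height-spec F v)))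
treedepth⇒derivation G (v , _) -[1+ _ ] (F , _ , depth≤ω) with depth≤ω v _ (proj₂ (reachRoot F v))
... | ()

+k≤ω : ∀ {k l} ω → suc k ≤ l → + l ℤ.≤ ω ℤ.+ + 1 → + k ℤ.≤ ω
+k≤ω         (+ d)           k<l l≤d+1     =
  +≤+ (s≤s⁻¹ (≤-trans k<l (≤-trans (drop‿+≤+ l≤d+1) (≤-reflexive (+-comm d 1)))))
+k≤ω {l = suc _} -[1+ zero ]  _   (+≤+ ())
+k≤ω         -[1+ suc _ ]    _   ()

derivation⇒treedepth : ∀ {n} (G : Graph n) ω →
                       HasDerivationOfLengthAtMost G (ω ℤ.+ + 1) → HasTDDOfDepthAtMost G ω
derivation⇒treedepth G ω (l , l≤ω+1 , P , D) =
  forest , decomposition , λ v k H → +k≤ω ω (height<l H) l≤ω+1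
  where open DerivationToTreedepth G l P D

mainTheorem5 : ∀ {n : ℕ} (G : Graph n) → Connected G → (ω : ℤ) →
    HasTDDOfDepthAtMost G ω ⇔ HasDerivationOfLengthAtMost G (ω ℤ.+ + 1)
mainTheorem5 G conn ω = mk⇔ (treedepth⇒derivation G conn ω) (derivation⇒treedepth G ω)
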